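{- Let $T$ be a tree on a finite set $I$ with $n$ inner vertices, fix a nice total order on $\mathcal V(T)$ and the associated edge-labeling $\lambda$ of $[\hat 0,T]$, and let $m:\hat 0=x_0\lhd x_1\lhd\cdots\lhd x_n=T$ be the unique maximal chain of $[\hat 0,T]$ with $\lambda(x_{i-1},x_i)=i$ for all $i\in[n]$. For $i\in[n]$ let $\mathsf A_i=\{a \text{ atom}: a\le x_i,\ a\not\le x_{i-1}\}$ and $\mathsf B_i=\{a \text{ atom}: \lambda(\hat 0,a)=i\}$. Then $\mathsf A_i=\mathsf B_i$ for every $i\in[n]$.
   Context: A tree on a finite set $I$ is a rooted binary tree (not considered as planar) whose leaves are bijectively labeled by $I$: every vertex is either an inner vertex of valence 3, or a vertex of valence 1 (a leaf or the root); edges are oriented towards the root. A forest on $I$ is a set of trees on pairwise disjoint label sets whose union is $I$; $\mathcal V(F)$ denotes its set of inner vertices. For forests $F,G$ on $I$, $F\le G$ means there is a continuous map from $F$ to $G$ such that: (D1) it is increasing with respect to the orientation towards the root; (D2) it maps inner vertices to inner vertices injectively; (D3) it restricts to the identity of $I$ on leaves; (D4) its restriction to each tree of $F$ is injective. This is a partial order on the set $\operatorname{For}(I)$ of forests on $I$, graded by the number of inner vertices, with minimum $\hat 0$ the forest with no inner vertices; the interval $[\hat 0,T]$ is a lattice. For distinct leaves $i,j$ of $T$, $v_{(i,j)}$ is the inner vertex of $T$ where the paths from $i$ and $j$ to the root meet; for $J\subseteq I$, $\mathcal S(J)=\{v_{(i,j)}: i\ne j\in J\}$. For $F\in[\hat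 0,T]$ whose trees have leaf sets $\pi_1,\dots,\pi_k$, the inner vertices of $F$ are identified with their images in $T$, so that $\mathcal V(F)=\mathcal S(\pi_1)\cup\dots\cup\mathcal S(\pi_k)\subseteq\mathcal V(T)$; if $F\lhd G$ (covering) in $[\hat 0,T]$ there is a unique $v$ with $\mathcal V(G)=\mathcal V(F)\cup\{v\}$. For $v,v'\in\mathcal V(T)$ write $v\preceq v'$ if $v'$ lies on the path between $v$ and the root; a nice total order is a total order on $\mathcal V(T)$ extending $\preceq$, and inner vertices are identified with $1,\dots,n$ increasingly in this order. The edge-labeling $\lambda$ is defined for $F\lhd G$ in $[\hat 0,T]$ by $\mathcal V(G)=\mathcal V(F)\cup\{\lambda(F,G)\}$. The atoms of $[\hat 0,T]$ are the forests whose only non-trivial tree has two leaves $i\ne j$; for such an atom $a$, $\lambda(\hat 0,a)$ is the label of $v_{(i,j)}$. -}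

module Defs where

open import Level using (0ℓ)
open import Data.Nat using (ℕ)
open import Data.Fin using (Fin; _≤_)
open import Data.Product using (Σ; ∃; _×_; _,_)
open import Data.Sum using (_⊎_)
open import Relation.Binary.PropositionalEquality using (_≡_; _≢_)
open import Relation.Binary using (Rel; IsEquivalence)
open import Relation.Nullary using (¬_)
open import Function.Definitions using (Bijective)

_⇔′_ : Set → Set → Set
A ⇔′ B = (A → B) × (B → A)

-- A 'node' is an inner vertex (valence 3); the root edge is implicit.
-- (Planar representation; all notions below are invariant under
--  swapping the two children, so this models non-planar trees.)

data Tree (k : ℕ) : Set where
  leaf : Fin k → Tree k
  node : Tree k → Tree k → Tree k

data _∈L_ {k : ℕ} (i : Fin k) : Tree k → Set where
  here  : i ∈L leaf i
  inl   : ∀ {l r} → i ∈L l → i ∈L node l r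
  inr   : ∀ {l r} → i ∈L r → i ∈L node l r

LabelledBijectively : {k : ℕ} → Tree k → Set
LabelledBijectively {k} T = (i : Fin k) → Σ (i ∈L T) (λ p → (q : i ∈L T) → q ≡ p)

-- inner vertices V(T) of a tree
data Pos {k : ℕ} : Tree k → Set where
  top   : ∀ {l r} → Pos (node l r)
  left  : ∀ {l r} → Pos l → Pos (node l r)
  right : ∀ {l r} → Pos r → Pos (node l r)

data _⪯_ {k : ℕ} : {T : Tree k} → Pos T → Pos T → Set where
  ⪯-top   : ∀ {l r} {v : Pos (node l r)} → v ⪯ top
  ⪯-left  : ∀ {l r} {v v' : Pos l} → v ⪯ v' → left {r = r} v ⪯ left v'
  ⪯-right : ∀ {l r} {v v' : Pos r} → v ⪯ v' → right {l = l} v ⪯ right v'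

-- Meet T i j v :  v = v_(i,j), the inner vertex where the paths from the
-- leaves i and j to the root meet
data Meet {k : ℕ} : (T : Tree k) → Fin k → Fin k → Pos T → Set where
  meet-top₁ : ∀ {l r i j} → i ∈L l → j ∈L r → Meet (node l r) i j top
  meet-top₂ : ∀ {l r i j} → j ∈L l → i ∈L r → Meet (node l r) i j top
  meet-left  : ∀ {l r i j v} → Meet l i j v → Meet (node l r) i j (left v)
  meet-right : ∀ {l r i j v} → Meet r i j v → Meet (node l r) i j (right v)

-- A nice total order on V(T): a bijection with the labels Fin n
-- (label t : Fin n stands for the integer t+1 ∈ [n]) extending ⪯.
record NiceOrder {k : ℕ} (T : Tree k) (n : ℕ) : Set where
  field
    ord       : Pos T → Fin n
    bijective : Bijective _≡_ _≡_ ord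
    extends   : ∀ {v v'} → v ⪯ v' → ord v ≤ ord v'

-- A forest F ≤ T is given by the
-- partition {π₁,…,π_k} of I into the leaf sets of its trees (each tree
-- being the restriction of T to its leaf set); condition (D2) says that
-- the images S(π_a) ⊆ V(T) are pairwise disjoint.

record Below {k : ℕ} (T : Tree k) : Set₁ where
  field
    _∼_   : Rel (Fin k) 0ℓ
    equiv : IsEquivalence _∼_
    disj  : ∀ {i j i' j' v} → Meet T i j v → Meet T i' j' v →
            i ∼ j → i' ∼ j' → i ∼ i'

module _ {k : ℕ} {T : Tree k} where
  open Below

  _≤F_ : Below T → Below T → Set
  F ≤F G = ∀ {i j} → _∼_ F i j → _∼_ G i j

  _<F_ : Below T → Below T → Set
  F <F G = F ≤F G × ¬ (G ≤F F)

  _⋖_ : Below T → Below T → Set₁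
  F ⋖ G = F <F G × ((H : Below T) → ¬ (F <F H × H <F G))

  InV : Below T → Pos T → Set
  InV F v = ∃ λ i → ∃ λ j → _∼_ F i j × Meet T i j v

  AddsVertex : Below T → Below T → Pos T → Set
  AddsVertex F G v = ¬ InV F v × ((w : Pos T) → InV G w ⇔′ (InV F w ⊎ w ≡ v))

  HasLabel : {n : ℕ} → NiceOrder T n → Below T → Below T → Fin n → Set
  HasLabel O F G t = Σ (Pos T) λ v → NiceOrder.ord O v ≡ t × AddsVertex F G v

  IsBottom : Below T → Set
  IsBottom F = ∀ i j → _∼_ F i j → i ≡ j

  IsTop : Below T → Set
  IsTop F = ∀ i j → _∼_ F i j

  IsAtom : Below T → Set
  IsAtom a = Σ (Fin k) λ i → Σ (Fin k) λ j → i ≢ j ×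
             (∀ p q → _∼_ a p q ⇔′ (p ≡ q ⊎ (p ≡ i × q ≡ j) ⊎ (p ≡ j × q ≡ i)))

{-# OPTIONS --safe #-}
-- Along the chain the labels force V(x s) to be the set of inner vertices of
-- order below s.  As a nice order extends ⪯, this set is closed downwards, and a
-- forest whose vertex set contains every vertex below v_(i,j) has i and j in one
-- tree; so i and j lie in one tree of x s exactly when ord v_(i,j) < s.  The atom
-- joining i and j lies below a forest iff i and j lie in one of its trees, and
-- its only inner vertex is v_(i,j); hence A_t and B_t both consist of the atoms
-- with ord v_(i,j) = t.
module Submission where

open import Defs
open import Level using (0ℓ)
open import Data.Nat using (ℕ; suc) renaming (_<_ to _<ℕ_)
import Data.Nat.Properties as ℕ
open import Data.Fin using (Fin; zero; suc; fromℕ; inject₁; toℕ; _<_)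
open import Data.Fin.Properties using (toℕ-injective; toℕ-inject₁)
open import Data.Fin.Induction using (<-weakInduction)
open import Data.Product using (_×_; _,_; proj₁; proj₂; ∃)
open import Data.Product.Function.NonDependent.Propositional using (_×-⇔_)
open import Data.Sum using (_⊎_; inj₁; inj₂)
open import Data.Sum.Function.Propositional using (_⊎-⇔_)
open import Function.Bundles using (_⇔_; mk⇔; Equivalence)
open import Function.Properties.Equivalence using () renaming (sym to ⇔-sym)
open import Function.Related.Propositional using (module EquationalReasoning; equivalence)
open import Function.Related.TypeIsomorphisms using (¬-cong-⇔)
open import Relation.Nullary using (¬_; contradiction)
open import Relation.Binary using (Rel; IsEquivalence)
open import Relation.Binary.PropositionalEquality using (_≡_; _≢_; refl; sym; trans; cong; subst)

open Equivalence using (to; from)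

<suc⇔<inject₁⊎≡ : ∀ {n} {i j : Fin n} → i < suc j ⇔ (i < inject₁ j ⊎ i ≡ j)
<suc⇔<inject₁⊎≡ {i = i} {j} = mk⇔ forward backward
  where
  forward : i < suc j → i < inject₁ j ⊎ i ≡ j
  forward i<1+j with ℕ.m<1+n⇒m<n∨m≡n i<1+j
  ... | inj₁ i<j = inj₁ (subst (toℕ i <ℕ_) (sym (toℕ-inject₁ j)) i<j)
  ... | inj₂ i≡j = inj₂ (toℕ-injective i≡j)

  backward : i < inject₁ j ⊎ i ≡ j → i < suc j
  backward (inj₁ i<j) = ℕ.m<n⇒m<1+n (subst (toℕ i <ℕ_) (toℕ-inject₁ j) i<j)
  backward (inj₂ refl) = ℕ.n<1+n (toℕ i)

<suc×≮inject₁⇔≡ : ∀ {n} {i j : Fin n} → (i < suc j × ¬ i < inject₁ j) ⇔ i ≡ j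
<suc×≮inject₁⇔≡ {i = i} {j} = mk⇔ forward backward
  where
  forward : i < suc j × ¬ i < inject₁ j → i ≡ j
  forward (i<1+j , i≮j) with to <suc⇔<inject₁⊎≡ i<1+j
  ... | inj₁ i<j = contradiction i<j i≮j
  ... | inj₂ i≡j = i≡j

  backward : i ≡ j → i < suc j × ¬ i < inject₁ j
  backward refl = from <suc⇔<inject₁⊎≡ (inj₂ refl) , ℕ.<-irrefl (sym (toℕ-inject₁ i))

module _ {k : ℕ} where

  UniqueLabels : Tree k → Set
  UniqueLabels S = ∀ {i} (p q : i ∈L S) → p ≡ q

  LabelledBijectively⇒UniqueLabels : ∀ {S} → LabelledBijectively S → UniqueLabels S
  LabelledBijectively⇒UniqueLabels bij {i} p q = trans (proj₂ (bij i) p) (sym (proj₂ (bij i) q))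

  UniqueLabels-left : ∀ {l r : Tree k} → UniqueLabels (node l r) → UniqueLabels l
  UniqueLabels-left u p q with u (inl p) (inl q)
  ... | refl = refl

  UniqueLabels-right : ∀ {l r : Tree k} → UniqueLabels (node l r) → UniqueLabels r
  UniqueLabels-right u p q with u (inr p) (inr q)
  ... | refl = refl

  UniqueLabels-disjoint : ∀ {l r : Tree k} {i} → UniqueLabels (node l r) → i ∈L l → ¬ i ∈L r
  UniqueLabels-disjoint u p q with u (inl p) (inr q)
  ... | ()

  Meet⇒∈L : ∀ {S : Tree k} {i j w} → Meet S i j w → i ∈L S × j ∈L S
  Meet⇒∈L (meet-top₁ i∈l j∈r) = inl i∈l , inr j∈r
  Meet⇒∈L (meet-top₂ j∈l i∈r) = inr i∈r , inl j∈l
  Meet⇒∈L (meet-left m)  = inl (proj₁ (Meet⇒∈L m)) , inl (proj₂ (Meet⇒∈L m))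
  Meet⇒∈L (meet-right m) = inr (proj₁ (Meet⇒∈L m)) , inr (proj₂ (Meet⇒∈L m))

  Meet-sym : ∀ {S : Tree k} {i j w} → Meet S i j w → Meet S j i w
  Meet-sym (meet-top₁ i∈l j∈r) = meet-top₂ i∈l j∈r
  Meet-sym (meet-top₂ j∈l i∈r) = meet-top₁ j∈l i∈r
  Meet-sym (meet-left m)  = meet-left (Meet-sym m)
  Meet-sym (meet-right m) = meet-right (Meet-sym m)

  Meet-irrefl : ∀ {S : Tree k} {i w} → UniqueLabels S → ¬ Meet S i i w
  Meet-irrefl u (meet-top₁ i∈l i∈r) = UniqueLabels-disjoint u i∈l i∈r
  Meet-irrefl u (meet-top₂ i∈l i∈r) = UniqueLabels-disjoint u i∈l i∈r
  Meet-irrefl u (meet-left m)  = Meet-irrefl (UniqueLabels-left u) m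
  Meet-irrefl u (meet-right m) = Meet-irrefl (UniqueLabels-right u) m

  Meet-exists : ∀ {S : Tree k} {i j} → i ∈L S → j ∈L S → i ≢ j → ∃ (Meet S i j)
  Meet-exists here here i≢i = contradiction refl i≢i
  Meet-exists (inl i∈l) (inl j∈l) i≢j with Meet-exists i∈l j∈l i≢j
  ... | w , m = left w , meet-left m
  Meet-exists (inl i∈l) (inr j∈r) _ = top , meet-top₁ i∈l j∈r
  Meet-exists (inr i∈r) (inl j∈l) _ = top , meet-top₂ j∈l i∈r
  Meet-exists (inr i∈r) (inr j∈r) i≢j with Meet-exists i∈r j∈r i≢j
  ... | w , m = right w , meet-right m

  Meet-top⇒¬Meet-left : ∀ {l r : Tree k} {i j v} → UniqueLabels (node l r) →
                        Meet (node l r) i j top → ¬ Meet l i j v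
  Meet-top⇒¬Meet-left u (meet-top₁ _ j∈r) m = UniqueLabels-disjoint u (proj₂ (Meet⇒∈L m)) j∈r
  Meet-top⇒¬Meet-left u (meet-top₂ _ i∈r) m = UniqueLabels-disjoint u (proj₁ (Meet⇒∈L m)) i∈r

  Meet-top⇒¬Meet-right : ∀ {l r : Tree k} {i j v} → UniqueLabels (node l r) →
                         Meet (node l r) i j top → ¬ Meet r i j v
  Meet-top⇒¬Meet-right u (meet-top₁ i∈l _) m = UniqueLabels-disjoint u i∈l (proj₁ (Meet⇒∈L m))
  Meet-top⇒¬Meet-right u (meet-top₂ j∈l _) m = UniqueLabels-disjoint u j∈l (proj₂ (Meet⇒∈L m))

  Meet-functional : ∀ {S : Tree k} {i j w w′} → UniqueLabels S → Meet S i j w → Meet S i j w′ → w ≡ w′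
  Meet-functional {w = top}     {w′ = top}     _ _ _ = refl
  Meet-functional {w = top}     {w′ = left _}  u m (meet-left m′)  = contradiction m′ (Meet-top⇒¬Meet-left u m)
  Meet-functional {w = top}     {w′ = right _} u m (meet-right m′) = contradiction m′ (Meet-top⇒¬Meet-right u m)
  Meet-functional {w = left _}  {w′ = top}     u (meet-left m) m′  = contradiction m (Meet-top⇒¬Meet-left u m′)
  Meet-functional {w = right _} {w′ = top}     u (meet-right m) m′ = contradiction m (Meet-top⇒¬Meet-right u m′)
  Meet-functional u (meet-left m)  (meet-left m′)  = cong left (Meet-functional (UniqueLabels-left u) m m′)
  Meet-functional u (meet-right m) (meet-right m′) = cong right (Meet-functional (UniqueLabels-right u) m m′)
  Meet-functional u (meet-left m)  (meet-right m′) =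
    contradiction (proj₁ (Meet⇒∈L m′)) (UniqueLabels-disjoint u (proj₁ (Meet⇒∈L m)))
  Meet-functional u (meet-right m) (meet-left m′)  =
    contradiction (proj₁ (Meet⇒∈L m)) (UniqueLabels-disjoint u (proj₁ (Meet⇒∈L m′)))

-- For S = T, Spanned is InV of the forest with relation ∼; allowing subtrees S
-- is what makes the induction go through.
module Spanning {k : ℕ} {_∼_ : Rel (Fin k) 0ℓ} (∼-equiv : IsEquivalence _∼_) where
  open IsEquivalence ∼-equiv renaming (refl to ∼-refl; sym to ∼-sym; trans to ∼-trans)

  Spanned : (S : Tree k) → Pos S → Set
  Spanned S v = ∃ λ i → ∃ λ j → i ∼ j × Meet S i j v

  Spanned-left : ∀ {l r v} → Spanned (node l r) (left v) → Spanned l v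
  Spanned-left (i , j , i∼j , meet-left m) = i , j , i∼j , m

  Spanned-right : ∀ {l r v} → Spanned (node l r) (right v) → Spanned r v
  Spanned-right (i , j , i∼j , meet-right m) = i , j , i∼j , m

  Spanned-top : ∀ {l r} → Spanned (node l r) top →
                ∃ λ p → ∃ λ q → p ∈L l × q ∈L r × p ∼ q
  Spanned-top (i , j , i∼j , meet-top₁ i∈l j∈r) = i , j , i∈l , j∈r , i∼j
  Spanned-top (i , j , i∼j , meet-top₂ j∈l i∈r) = j , i , j∈l , i∈r , ∼-sym i∼j

  -- The top vertex is spanned by a pair straddling the two children, and each
  -- child's leaves form a single class by induction.
  all-Spanned⇒leaves-related : ∀ S → (∀ v → Spanned S v) →
                               ∀ {i j} → i ∈L S → j ∈L S → i ∼ j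
  all-Spanned⇒leaves-related (leaf _) _ here here = ∼-refl
  all-Spanned⇒leaves-related (node l r) spanned i∈S j∈S with Spanned-top (spanned top)
  ... | p , q , p∈l , q∈r , p∼q = ∼-trans (∼p i∈S) (∼-sym (∼p j∈S))
    where
    ∼p : ∀ {m} → m ∈L node l r → m ∼ p
    ∼p (inl m∈l) = all-Spanned⇒leaves-related l (λ v → Spanned-left (spanned (left v))) m∈l p∈l
    ∼p (inr m∈r) =
      ∼-trans (all-Spanned⇒leaves-related r (λ v → Spanned-right (spanned (right v))) m∈r q∈r) (∼-sym p∼q)

  Spanned-below⇒related : ∀ S {i j w} → Meet S i j w → (∀ v → v ⪯ w → Spanned S v) → i ∼ j
  Spanned-below⇒related S (meet-top₁ i∈l j∈r) spanned =
    all-Spanned⇒leaves-related S (λ v → spanned v ⪯-top) (inl i∈l) (inr j∈r)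
  Spanned-below⇒related S (meet-top₂ j∈l i∈r) spanned =
    all-Spanned⇒leaves-related S (λ v → spanned v ⪯-top) (inr i∈r) (inl j∈l)
  Spanned-below⇒related (node l r) (meet-left m) spanned =
    Spanned-below⇒related l m (λ v v⪯w → Spanned-left (spanned (left v) (⪯-left v⪯w)))
  Spanned-below⇒related (node l r) (meet-right m) spanned =
    Spanned-below⇒related r m (λ v v⪯w → Spanned-right (spanned (right v) (⪯-right v⪯w)))

module _ {k : ℕ} {T : Tree k} where
  open Below

  IsBottom⇒¬InV : ∀ {F v} → UniqueLabels T → IsBottom F → ¬ InV F v
  IsBottom⇒¬InV u bottom (i , j , i∼j , m) with bottom i j i∼j
  ... | refl = Meet-irrefl u m

  AtomOn : Below T → Fin k → Fin k → Set
  AtomOn a i j = ∀ p q → _∼_ a p q ⇔′ (p ≡ q ⊎ (p ≡ i × q ≡ j) ⊎ (p ≡ j × q ≡ i))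

  AtomOn-≤F⇔∼ : ∀ {a F i j} → AtomOn a i j → (a ≤F F) ⇔ _∼_ F i j
  AtomOn-≤F⇔∼ {a} {F} {i} {j} atom = mk⇔ (λ a≤F → a≤F a-ij) backward
    where
    open IsEquivalence (equiv F) renaming (refl to ∼-refl; sym to ∼-sym)
    a-ij : _∼_ a i j
    a-ij = proj₂ (atom i j) (inj₂ (inj₁ (refl , refl)))

    backward : _∼_ F i j → a ≤F F
    backward F-ij {p} {q} a-pq with proj₁ (atom p q) a-pq
    ... | inj₁ refl = ∼-refl
    ... | inj₂ (inj₁ (refl , refl)) = F-ij
    ... | inj₂ (inj₂ (refl , refl)) = ∼-sym F-ij

  AtomOn-InV⇔≡ : ∀ {a i j w v} → UniqueLabels T → AtomOn a i j → Meet T i j w → InV a v ⇔ v ≡ w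
  AtomOn-InV⇔≡ {a} {i} {j} {w} {v} u atom m = mk⇔ forward backward
    where
    forward : InV a v → v ≡ w
    forward (p , q , a-pq , m′) with proj₁ (atom p q) a-pq
    ... | inj₁ refl = contradiction m′ (Meet-irrefl u)
    ... | inj₂ (inj₁ (refl , refl)) = Meet-functional u m′ m
    ... | inj₂ (inj₂ (refl , refl)) = Meet-functional u (Meet-sym m′) m

    backward : v ≡ w → InV a v
    backward refl = i , j , proj₂ (atom i j) (inj₂ (inj₁ (refl , refl))) , m

  AtomOn-HasLabel⇔ord≡ : ∀ {n} (O : NiceOrder T n) {b a i j w t} → UniqueLabels T → IsBottom b →
                         AtomOn a i j → Meet T i j w → HasLabel O b a t ⇔ NiceOrder.ord O w ≡ t
  AtomOn-HasLabel⇔ord≡ O {b} {a} {w = w} {t} u bottom atom m = mk⇔ forward backward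
    where
    open NiceOrder O
    V-a : ∀ {v} → InV a v ⇔ v ≡ w
    V-a = AtomOn-InV⇔≡ {a = a} u atom m

    V-b : ∀ {v} → ¬ InV b v
    V-b = IsBottom⇒¬InV {F = b} u bottom

    forward : HasLabel O b a t → ord w ≡ t
    forward (v , ord-v≡t , _ , adds) with proj₁ (adds w) (from V-a refl)
    ... | inj₁ w∈b = contradiction w∈b V-b
    ... | inj₂ refl = ord-v≡t

    backward : ord w ≡ t → HasLabel O b a t
    backward ord-w≡t = w , ord-w≡t , V-b , λ v →
      (λ v∈a → inj₂ (to V-a v∈a)) ,
      λ { (inj₁ v∈b) → contradiction v∈b V-b
        ; (inj₂ v≡w) → from V-a v≡w }

module LabelledChain {k n : ℕ} {T : Tree k} (u : UniqueLabels T) (O : NiceOrder T n)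
                     (x : Fin (suc n) → Below T) (bottom : IsBottom (x zero))
                     (labelled : (t : Fin n) → HasLabel O (x (inject₁ t)) (x (suc t)) t) where
  open NiceOrder O
  open Below

  IsInitialSegment : Fin (suc n) → Set
  IsInitialSegment s = ∀ w → InV (x s) w ⇔ ord w < s

  InV⇔ord< : ∀ s → IsInitialSegment s
  InV⇔ord< = <-weakInduction IsInitialSegment base step
    where
    base : IsInitialSegment zero
    base w = mk⇔ (λ w∈x₀ → contradiction w∈x₀ (IsBottom⇒¬InV {F = x zero} u bottom)) (λ ())

    step : ∀ t → IsInitialSegment (inject₁ t) → IsInitialSegment (suc t)
    step t ih w with labelled t
    ... | v , ord-v≡t , _ , adds = begin
      InV (x (suc t)) w                   ∼⟨ mk⇔ (proj₁ (adds w)) (proj₂ (adds w)) ⟩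
      (InV (x (inject₁ t)) w ⊎ w ≡ v)     ∼⟨ ih w ⊎-⇔ w≡v⇔ord≡ ⟩
      (ord w < inject₁ t ⊎ ord w ≡ t)     ∼⟨ ⇔-sym <suc⇔<inject₁⊎≡ ⟩
      ord w < suc t                       ∎
      where
      open EquationalReasoning {k = equivalence}
      w≡v⇔ord≡ : w ≡ v ⇔ ord w ≡ t
      w≡v⇔ord≡ = mk⇔ (λ { refl → ord-v≡t })
                     (λ ord-w≡t → proj₁ bijective (trans ord-w≡t (sym ord-v≡t)))

  -- The converse uses that V(x s) is closed downwards, as the nice order extends ⪯.
  ∼⇔ord< : ∀ s {i j w} → Meet T i j w → _∼_ (x s) i j ⇔ ord w < s
  ∼⇔ord< s {i} {j} m = mk⇔
    (λ i∼j → to (InV⇔ord< s _) (i , j , i∼j , m))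
    (λ w<s → Spanning.Spanned-below⇒related (equiv (x s)) T m
               (λ v v⪯w → from (InV⇔ord< s v) (ℕ.≤-<-trans (extends v⪯w) w<s)))

mainTheorem11 : {k n : ℕ} (T : Tree k) → LabelledBijectively T →
    (O : NiceOrder T n) →
    (x : Fin (suc n) → Below T) →
    IsBottom (x zero) → IsTop (x (fromℕ n)) →
    ((t : Fin n) → x (inject₁ t) ⋖ x (suc t)) →
    ((t : Fin n) → HasLabel O (x (inject₁ t)) (x (suc t)) t) →
    (t : Fin n) (a : Below T) → IsAtom a →
    (a ≤F x (suc t) × ¬ (a ≤F x (inject₁ t))) ⇔′ HasLabel O (x zero) a t
mainTheorem11 T bij O x bottom _ _ labelled t a (i , j , i≢j , atom)
  with Meet-exists (proj₁ (bij i)) (proj₁ (bij j)) i≢j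
... | w , m = to A⇔B , from A⇔B
  where
  u : UniqueLabels T
  u = LabelledBijectively⇒UniqueLabels bij

  open NiceOrder O
  open LabelledChain u O x bottom labelled
  open EquationalReasoning {k = equivalence}

  A⇔B : (a ≤F x (suc t) × ¬ (a ≤F x (inject₁ t))) ⇔ HasLabel O (x zero) a t
  A⇔B = begin
    (a ≤F x (suc t) × ¬ (a ≤F x (inject₁ t)))
      ∼⟨ AtomOn-≤F⇔∼ {a = a} {F = x (suc t)} atom
           ×-⇔ ¬-cong-⇔ (AtomOn-≤F⇔∼ {a = a} {F = x (inject₁ t)} atom) ⟩
    (Below._∼_ (x (suc t)) i j × ¬ Below._∼_ (x (inject₁ t)) i j)
      ∼⟨ ∼⇔ord< (suc t) m ×-⇔ ¬-cong-⇔ (∼⇔ord< (inject₁ t) m) ⟩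
    (ord w < suc t × ¬ ord w < inject₁ t)
      ∼⟨ <suc×≮inject₁⇔≡ ⟩
    ord w ≡ t
      ∼⟨ ⇔-sym (AtomOn-HasLabel⇔ord≡ O {b = x zero} {a = a} u bottom atom m) ⟩
    HasLabel O (x zero) a t ∎
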